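{- For every integer $k\geq 5$, the collection $\mathcal{C}_k$ is nonempty; that is, there exists a distinct minimal covering system with exactly $k$ moduli.
   Context: For $a,m\in\mathbb{Z}$ with $m\geq 2$, the congruence class $a \pmod m$ is the set of integers congruent to $a$ modulo $m$. A system of congruences is a finite collection $\{r_1 \pmod{m_1},\dots,r_k \pmod{m_k}\}$ of congruence classes (each $m_i\geq 2$). It is a covering system if every integer lies in at least one of the classes; it is distinct if the moduli are pairwise distinct; it is minimal if removing any one of the classes yields a system that is no longer a covering system. $\mathcal{C}_k$ denotes the collection of all distinct minimal covering systems with exactly $k$ moduli. -}

module Defs where

open import Data.Nat using (ℕ; _≤_)
open import Data.Integer using (ℤ; +_; _-_)
open import Data.Integer.Divisibility using (_∣_)
open import Data.Product using (_×_; proj₁; proj₂; ∃)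
open import Data.List using (List; map; length; removeAt)
open import Data.List.Relation.Unary.Any using (Any)
open import Data.List.Relation.Unary.All using (All)
open import Data.List.Relation.Unary.Unique.Propositional using (Unique)
open import Data.Fin using (Fin)
open import Relation.Nullary using (¬_)
open import Relation.Binary.PropositionalEquality using (_≡_)

Congruence : Set
Congruence = ℤ × ℕ

residue : Congruence → ℤ
residue = proj₁

modulus : Congruence → ℕ
modulus = proj₂

_∈Class_ : ℤ → Congruence → Set
x ∈Class c = (+ modulus c) ∣ (x - residue c)

System : Set
System = List Congruence

ValidSystem : System → Set
ValidSystem S = All (λ c → 2 ≤ modulus c) S

Covering : System → Set
Covering S = (x : ℤ) → Any (x ∈Class_) S

Distinct : System → Set
Distinct S = Unique (map modulus S)

Minimal : System → Set
Minimal S = (i : Fin (length S)) → ¬ Covering (removeAt S i)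

InC : ℕ → System → Set
InC k S = ValidSystem S × Covering S × Distinct S × Minimal S × length S ≡ k

-- Starting from the covering system {0 (mod 2), 0 (mod 3), 1 (mod 4), 5 (mod 6), 7 (mod 12)}
-- with five moduli, one passes from k to k + 1 moduli by "doubling": the even integers are
-- covered by 0 (mod 2), and the odd integers 2y + 1 by the images r (mod m) ↦ 2r + 1 (mod 2m)
-- of the old classes. The moduli stay distinct (they are doubled, and all exceed 2), and
-- minimality survives in the stronger form that each class contains an integer lying in no
-- other class: 0 for the new class, and 2y + 1 for the image of a class with private point y.
module Submission where

open import Defs
open import Data.Nat using (ℕ; _≤_)
open import Data.Product using (∃)

open import Data.Nat as ℕ using (zero; suc; NonZero)
import Data.Nat.Properties as ℕ
import Data.Nat.Divisibility as ℕ
open import Data.Integer as ℤ using (ℤ; +_; _+_; _-_; _*_)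
import Data.Integer.Properties as ℤ
open import Data.Integer.Divisibility using (_∣_; *-monoʳ-∣; *-cancelˡ-∣)
import Data.Integer.Divisibility.Signed as ℤˢ
open import Data.Integer.DivMod using (_%ℕ_; _/ℕ_; n%ℕd<d; a≡a%ℕn+[a/ℕn]*n)
open import Data.Integer.Tactic.RingSolver using (solve-∀)
open import Data.Product using (_×_; _,_)
open import Data.Sum using (_⊎_; inj₁; inj₂)
open import Data.List using ([]; _∷_; map; length; removeAt; lookup)
open import Data.List.Properties using (map-∘; length-map)
open import Data.List.Relation.Unary.Any as Any using (Any; here; there)
import Data.List.Relation.Unary.Any.Properties as Any
open import Data.List.Relation.Unary.All as All using (All; _∷_)
import Data.List.Relation.Unary.All.Properties as All
open import Data.List.Relation.Unary.AllPairs using (allPairs?; _∷_)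
open import Data.List.Relation.Unary.Unique.Propositional using (Unique)
import Data.List.Relation.Unary.Unique.Propositional.Properties as Unique
open import Data.Fin using (Fin; zero; suc; toℕ; fromℕ<)
open import Data.Fin.Properties using (toℕ-fromℕ<)
import Data.Fin.Properties as Fin
open import Function using (_∘_)
open import Relation.Nullary using (¬_; Dec; ¬?; _×-dec_; contradiction)
open import Relation.Nullary.Decidable using (from-yes)
open import Relation.Binary.PropositionalEquality
open ≡-Reasoning

infix 4 _∉Class_

_∉Class_ : ℤ → Congruence → Set
x ∉Class c = ¬ x ∈Class c

_∈Class?_ : ∀ x c → Dec (x ∈Class c)
x ∈Class? c = modulus c ℕ.∣? ℤ.∣ x - residue c ∣

∈Class-+multiple : ∀ {N} y q c → modulus c ℕ.∣ N → y ∈Class c → (y + q * + N) ∈Class c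
∈Class-+multiple {N} y q (r , m) m∣N y∈c = ℤˢ.∣⇒∣ᵤ (subst (ℤˢ._∣_ (+ m)) (sym (shift y q r (+ N)))
  (ℤˢ.∣m∣n⇒∣m+n (ℤˢ.∣ᵤ⇒∣ {+ m} {y - r} y∈c) (ℤˢ.∣n⇒∣m*n q (ℤˢ.∣ᵤ⇒∣ {+ m} {+ N} m∣N))))
  where
  shift : ∀ y q r n → y + q * n - r ≡ (y - r) + q * n
  shift = solve-∀

Any-∈Class-+multiple : ∀ {N} y q {S} → All (λ c → modulus c ℕ.∣ N) S →
  Any (y ∈Class_) S → Any ((y + q * + N) ∈Class_) S
Any-∈Class-+multiple y q (m∣N ∷ _) (here y∈c) = here (∈Class-+multiple y q _ m∣N y∈c)
Any-∈Class-+multiple y q (_ ∷ moduli∣N) (there y∈S) =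
  there (Any-∈Class-+multiple y q moduli∣N y∈S)

covering-from-period : ∀ N .{{_ : NonZero N}} S → All (λ c → modulus c ℕ.∣ N) S →
  (∀ (t : Fin N) → Any ((+ toℕ t) ∈Class_) S) → Covering S
covering-from-period N S moduli∣N covers x = subst (λ x → Any (x ∈Class_) S) (sym x≡r+qN)
  (Any-∈Class-+multiple r q moduli∣N r∈S)
  where
  q : ℤ
  q = x /ℕ N
  r : ℤ
  r = + (x %ℕ N)
  x≡r+qN : x ≡ r + q * + N
  x≡r+qN = a≡a%ℕn+[a/ℕn]*n x N
  r∈S : Any (r ∈Class_) S
  r∈S = subst (λ t → Any ((+ t) ∈Class_) S) (toℕ-fromℕ< (n%ℕd<d x N))
    (covers (fromℕ< (n%ℕd<d x N)))

odd : ℤ → ℤ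
odd y = + 2 * y + + 1

oddImage : Congruence → Congruence
oddImage c = odd (residue c) , 2 ℕ.* modulus c

odd-difference : ∀ y r → odd y - odd r ≡ + 2 * (y - r)
odd-difference = difference
  where
  -- stated with odd unfolded, since the ring solver does not see through definitions
  difference : ∀ y r → (+ 2 * y + + 1) - (+ 2 * r + + 1) ≡ + 2 * (y - r)
  difference = solve-∀

∈Class-oddImage⁺ : ∀ y c → y ∈Class c → odd y ∈Class oddImage c
∈Class-oddImage⁺ y (r , m) y∈c =
  subst₂ _∣_ (sym (ℤ.pos-* 2 m)) (sym (odd-difference y r)) (*-monoʳ-∣ (+ 2) {+ m} {y - r} y∈c)

∈Class-oddImage⁻ : ∀ y c → odd y ∈Class oddImage c → y ∈Class c
∈Class-oddImage⁻ y (r , m) oy∈c =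
  *-cancelˡ-∣ (+ 2) {+ m} {y - r} (subst₂ _∣_ (ℤ.pos-* 2 m) (odd-difference y r) oy∈c)

two-∤-odd : ∀ y → ¬ (+ 2 ∣ odd y)
two-∤-odd y 2∣odd = contradiction (ℕ.∣1⇒≡1 2∣1) λ ()
  where
  2∣1 : 2 ℕ.∣ 1
  2∣1 = ℤˢ.∣⇒∣ᵤ (ℤˢ.∣m+n∣m⇒∣n {+ 2} {+ 2 * y} (ℤˢ.∣ᵤ⇒∣ 2∣odd) (ℤˢ.∣m⇒∣m*n y ℤˢ.∣-refl))

odd∉evens : ∀ y → odd y ∉Class (+ 0 , 2)
odd∉evens y = two-∤-odd y ∘ subst (+ 2 ∣_) (ℤ.+-identityʳ (odd y))

-- 2m ∣ 0 - (2r + 1) would make 2r + 1 even.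
0∉oddImage : ∀ c → (+ 0) ∉Class oddImage c
0∉oddImage (r , m) 2m∣-odd = two-∤-odd r (ℕ.∣-trans (ℕ.m∣m*n m) 2m∣odd)
  where
  2m∣odd : 2 ℕ.* m ℕ.∣ ℤ.∣ odd r ∣
  2m∣odd = subst (2 ℕ.* m ℕ.∣_)
    (trans (cong ℤ.∣_∣ (ℤ.+-identityˡ (ℤ.- odd r))) (ℤ.∣-i∣≡∣i∣ (odd r))) 2m∣-odd

even-or-odd : ∀ x → x ∈Class (+ 0 , 2) ⊎ ∃ λ y → x ≡ odd y
even-or-odd x with x %ℕ 2 | n%ℕd<d x 2 | a≡a%ℕn+[a/ℕn]*n x 2
... | 0 | _ | x≡2q = inj₁ (subst (+ 2 ∣_) (sym (ℤ.+-identityʳ x))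
                          (ℤˢ.∣⇒∣ᵤ (ℤˢ.divides (x /ℕ 2) (trans x≡2q (ℤ.+-identityˡ _)))))
... | 1 | _ | x≡2q+1 = inj₂ (x /ℕ 2 , trans x≡2q+1 (1+q*2≡odd (x /ℕ 2)))
  where
  1+q*2≡odd : ∀ q → + 1 + q * + 2 ≡ + 2 * q + + 1
  1+q*2≡odd = solve-∀
... | suc (suc _) | ℕ.s≤s (ℕ.s≤s ()) | _

HasPrivatePoints : System → Set
HasPrivatePoints S = (i : Fin (length S)) →
  ∃ λ x → x ∈Class lookup S i × All (x ∉Class_) (removeAt S i)

hasPrivatePoints⇒minimal : ∀ S → HasPrivatePoints S → Minimal S
hasPrivatePoints⇒minimal S privatePoints i covering with privatePoints i
... | x , _ , x∉rest = All.All¬⇒¬Any x∉rest (covering x)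

lookup-removeAt-map : ∀ {A B : Set} (f : A → B) xs (j : Fin (length (map f xs))) →
  ∃ λ i → lookup (map f xs) j ≡ f (lookup xs i) × removeAt (map f xs) j ≡ map f (removeAt xs i)
lookup-removeAt-map f (x ∷ xs) zero = zero , refl , refl
lookup-removeAt-map f (x ∷ xs) (suc j) with lookup-removeAt-map f xs j
... | i , lookup≡ , removeAt≡ = suc i , lookup≡ , cong (f x ∷_) removeAt≡

double : System → System
double S = (+ 0 , 2) ∷ map oddImage S

double-valid : ∀ S → ValidSystem S → ValidSystem (double S)
double-valid S valid =
  ℕ.≤-refl ∷ All.map⁺ (All.map (λ {c} 2≤m → ℕ.≤-trans 2≤m (ℕ.m≤n*m (modulus c) 2)) valid)

double-covering : ∀ S → Covering S → Covering (double S)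
double-covering S covering x with even-or-odd x
... | inj₁ x∈evens = here x∈evens
... | inj₂ (y , refl) = there (Any.map⁺ (Any.map (∈Class-oddImage⁺ y _) (covering y)))

moduli-double : ∀ S → map modulus (map oddImage S) ≡ map (2 ℕ.*_) (map modulus S)
moduli-double S = begin
  map modulus (map oddImage S)        ≡⟨ map-∘ S ⟨
  map (λ c → 2 ℕ.* modulus c) S       ≡⟨ map-∘ S ⟩
  map (2 ℕ.*_) (map modulus S)        ∎

double-distinct : ∀ S → ValidSystem S → Distinct S → Distinct (double S)
double-distinct S valid distinct = 2∉doubled ∷ subst Unique (sym (moduli-double S))
  (Unique.map⁺ (ℕ.*-cancelˡ-≡ _ _ 2) distinct)
  where
  2<2*m : ∀ {m} → 2 ≤ m → 2 ℕ.< 2 ℕ.* m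
  2<2*m {m} 2≤m = ℕ.<-≤-trans (ℕ.m<m*n 2 2 ℕ.≤-refl) (ℕ.*-monoʳ-≤ 2 2≤m)

  2∉doubled : All (2 ≢_) (map modulus (map oddImage S))
  2∉doubled = All.map⁺ (All.map⁺ (All.map (λ 2≤m 2≡2m → ℕ.<-irrefl 2≡2m (2<2*m 2≤m)) valid))

double-hasPrivatePoints : ∀ S → HasPrivatePoints S → HasPrivatePoints (double S)
double-hasPrivatePoints S privatePoints zero =
  + 0 , ℕ._∣0 2 , All.map⁺ (All.universal 0∉oddImage S)
double-hasPrivatePoints S privatePoints (suc j) with lookup-removeAt-map oddImage S j
... | i , lookup≡ , removeAt≡ with privatePoints i
... | y , y∈ci , y∉rest =
  odd y , subst (odd y ∈Class_) (sym lookup≡) (∈Class-oddImage⁺ y (lookup S i) y∈ci) ,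
  odd∉evens y ∷ subst (All (odd y ∉Class_)) (sym removeAt≡)
    (All.map⁺ (All.map (λ {c} y∉c → y∉c ∘ ∈Class-oddImage⁻ y c) y∉rest))

base : System
base = (+ 0 , 2) ∷ (+ 0 , 3) ∷ (+ 1 , 4) ∷ (+ 5 , 6) ∷ (+ 7 , 12) ∷ []

base-valid : ValidSystem base
base-valid = from-yes (All.all? (λ c → 2 ℕ.≤? modulus c) base)

base-distinct : Distinct base
base-distinct = from-yes (allPairs? (λ m n → ¬? (m ℕ.≟ n)) (map modulus base))

base-covering : Covering base
base-covering = covering-from-period 12 base
  (from-yes (All.all? (λ c → modulus c ℕ.∣? 12) base))
  (from-yes (Fin.all? {n = 12} (λ t → Any.any? ((+ toℕ t) ∈Class?_) base)))

basePrivatePoint : Fin (length base) → ℤ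
basePrivatePoint zero = + 2
basePrivatePoint (suc zero) = + 3
basePrivatePoint (suc (suc zero)) = + 1
basePrivatePoint (suc (suc (suc zero))) = + 11
basePrivatePoint (suc (suc (suc (suc zero)))) = + 7

base-hasPrivatePoints : HasPrivatePoints base
base-hasPrivatePoints i = basePrivatePoint i , from-yes (Fin.all? isPrivate?) i
  where
  isPrivate? : ∀ i → Dec (basePrivatePoint i ∈Class lookup base i ×
                           All (basePrivatePoint i ∉Class_) (removeAt base i))
  isPrivate? i = (basePrivatePoint i ∈Class? lookup base i)
    ×-dec All.all? (λ c → ¬? (basePrivatePoint i ∈Class? c)) (removeAt base i)

-- Membership in 𝒞ₖ with minimality strengthened to the form that doubling preserves.
InC⁺ : ℕ → System → Set
InC⁺ k S = ValidSystem S × Covering S × Distinct S × HasPrivatePoints S × length S ≡ k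

InC⁺⇒InC : ∀ {k} S → InC⁺ k S → InC k S
InC⁺⇒InC S (valid , covering , distinct , privatePoints , length≡k) =
  valid , covering , distinct , hasPrivatePoints⇒minimal S privatePoints , length≡k

base-InC⁺ : InC⁺ 5 base
base-InC⁺ = base-valid , base-covering , base-distinct , base-hasPrivatePoints , refl

double-InC⁺ : ∀ {k} S → InC⁺ k S → InC⁺ (suc k) (double S)
double-InC⁺ S (valid , covering , distinct , privatePoints , length≡k) =
  double-valid S valid , double-covering S covering , double-distinct S valid distinct ,
  double-hasPrivatePoints S privatePoints , cong suc (trans (length-map oddImage S) length≡k)

InC⁺-from-5 : ∀ n → ∃ (InC⁺ (5 ℕ.+ n))
InC⁺-from-5 zero = base , base-InC⁺
InC⁺-from-5 (suc n) with InC⁺-from-5 n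
... | S , S∈C⁺ = double S , double-InC⁺ S S∈C⁺

corollary2p10 : (k : ℕ) → 5 ≤ k → ∃ (λ S → InC k S)
corollary2p10 k 5≤k with ℕ.m≤n⇒∃[o]m+o≡n 5≤k
... | n , refl with InC⁺-from-5 n
... | S , S∈C⁺ = S , InC⁺⇒InC S S∈C⁺
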